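{- For every $\sigma\in\mathfrak{S}_n$, $\mathsf{Lmil}(\sigma)=\mathsf{Lmic}_1(\phi(\sigma))$, where $\phi=B^{ -1}\circ A$.
   Context: $\mathfrak{S}_n$ is the symmetric group on $[n]$, permutations in one-line notation $\sigma=\sigma_1\cdots\sigma_n$. Lehmer code: $\mathsf{Leh}(\sigma)=(\ell_1,\dots,\ell_n)$, $\ell_i=\#\{j\le i:\sigma_j\le\sigma_i\}$, a bijection onto $\mathcal{L}_n=\{(\ell_1,\dots,\ell_n):1\le\ell_i\le i\}$. $A(\sigma)=\mathsf{Leh}(\sigma^{ -1})$. $B(\sigma)=(b_1,\dots,b_n)$ with $b_i=\sigma^{ -k_i}(i)$, $k_i\ge1$ smallest with $\sigma^{ -k_i}(i)\le i$; $B:\mathfrak{S}_n\to\mathcal{L}_n$ is a bijection. $O((\ell_1,\dots,\ell_n))=\{i:\ell_i=1\}$. $\mathsf{Lmil}(\sigma)=\{\sigma_i:\sigma_i<\sigma_j\text{ for all }j<i\}$ and $\mathsf{Lmic}_1(\sigma)=O(B(\sigma))$. -}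

module Defs where

open import Data.Nat using (ℕ; zero; suc)
open import Data.Fin using (Fin; toℕ; _≤?_; _≤_; _<_)
open import Data.Fin.Permutation using (Permutation′; _⟨$⟩ʳ_; _⟨$⟩ˡ_)
open import Data.List using (List; length; filter; allFin)
open import Data.Vec using (Vec; tabulate)
open import Data.Product using (Σ; _×_)
open import Relation.Nullary using (yes; no)
open import Relation.Nullary.Decidable using (_×-dec_)
open import Relation.Binary.PropositionalEquality using (_≡_)

-- Conventions: [n] is represented by Fin n, with element k : Fin n standing
-- for the integer (toℕ k + 1).  A permutation σ ∈ 𝔖ₙ is a Permutation′ n;
-- σ ⟨$⟩ʳ i is σᵢ and σ ⟨$⟩ˡ i is σ⁻¹(i).
-- A Lehmer code (ℓ₁,…,ℓₙ) is a Vec ℕ n whose entries are the (1-based) values ℓᵢ.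

Leh : ∀ {n} → Permutation′ n → Vec ℕ n
Leh {n} σ = tabulate λ i →
  length (filter (λ j → (j ≤? i) ×-dec ((σ ⟨$⟩ʳ j) ≤? (σ ⟨$⟩ʳ i))) (allFin n))

inv : ∀ {n} → Permutation′ n → Permutation′ n
inv σ = Data.Fin.Permutation.flip σ

A : ∀ {n} → Permutation′ n → Vec ℕ n
A σ = Leh (inv σ)

-- Started at x = i with fuel n it returns
-- σ^{-kᵢ}(i) with kᵢ ≥ 1 minimal such that σ^{-kᵢ}(i) ≤ i (the cycle of i
-- returns to i after at most n steps, so the fuel never runs out).
firstBelow : ∀ {n} → Permutation′ n → Fin n → ℕ → Fin n → Fin n
firstBelow σ i zero    x = i
firstBelow σ i (suc f) x with (σ ⟨$⟩ˡ x) ≤? i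
... | yes _ = σ ⟨$⟩ˡ x
... | no  _ = firstBelow σ i f (σ ⟨$⟩ˡ x)

B : ∀ {n} → Permutation′ n → Vec ℕ n
B {n} σ = tabulate λ i → suc (toℕ (firstBelow σ i n i))

_∈O_ : ∀ {n} → Fin n → Vec ℕ n → Set
i ∈O ℓ = Data.Vec.lookup ℓ i ≡ 1

_∈Lmil_ : ∀ {n} → Fin n → Permutation′ n → Set
_∈Lmil_ {n} v σ = Σ (Fin n) λ i → (σ ⟨$⟩ʳ i ≡ v) × (∀ (j : Fin n) → j < i → (σ ⟨$⟩ʳ i) < (σ ⟨$⟩ʳ j))

_∈Lmic₁_ : ∀ {n} → Fin n → Permutation′ n → Set
i ∈Lmic₁ σ = i ∈O B σ

-- A(σ)ᵥ counts the values w ≤ v that occur in σ no later than v, so it equals 1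
-- exactly when v is a left-to-right minimum of σ; and Lmic₁(τ) is the set of
-- positions where B(τ) is 1, so the equivalence holds for every τ with B τ = A σ.
-- Such τ exists because B is onto the Lehmer codes: to realise targets cᵢ ≤ i,
-- splice m = 0, 1, … into the cycles of τ⁻¹ just before c_m (by a transposition).
-- As m exceeds every earlier i, this only lengthens the excursions above i, so the
-- earlier values bᵢ survive.  The search for bᵢ ends within n steps because an
-- excursion from i never repeats a point.

module Submission where

open import Defs
open import Data.Nat.Base as ℕ using (ℕ; zero; suc; s≤s; _+_; _∸_)
import Data.Nat.Properties as ℕₚ
open import Data.Fin.Base as F using (Fin; toℕ)
open import Data.Fin.Properties as Fₚ using (_≟_; _≤?_)
open import Data.Fin.Permutation as P using (Permutation′; _⟨$⟩ʳ_; _⟨$⟩ˡ_; inverseˡ; inverseʳ)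
import Data.Fin.Permutation.Components as PC
open import Data.List.Base using (List; []; _∷_; length; filter; allFin; map; tabulate)
open import Data.List.Properties using (map-tabulate; filter-none; filter-some)
open import Data.List.Membership.Propositional using (_∈_; lose)
open import Data.List.Membership.Propositional.Properties using (∈-allFin; ∈-filter⁺; ∈-filter⁻)
open import Data.List.Relation.Unary.Any using (here; there)
open import Data.List.Relation.Unary.All as All using ([]; _∷_)
open import Data.List.Relation.Unary.AllPairs using ([]; _∷_)
open import Data.List.Relation.Unary.Unique.Propositional using (Unique)
import Data.List.Relation.Unary.Unique.Propositional.Properties as Unique
open import Data.Vec.Base as Vec using (Vec; lookup)
open import Data.Vec.Properties using (lookup∘tabulate; tabulate∘lookup; tabulate-cong)
open import Data.Product.Base using (Σ; _×_; _,_; proj₁; proj₂)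
open import Data.Sum.Base using (inj₁; inj₂)
open import Function.Base using (_∘_)
open import Function.Bundles using (_⇔_; mk⇔)
open import Function.Definitions using (Injective)
import Function.Properties.Equivalence as ⇔
open import Level using (Level)
open import Relation.Nullary using (yes; no; contradiction)
open import Relation.Nullary.Decidable using (_×-dec_)
open import Relation.Unary using (Pred; Decidable)
open import Relation.Binary.PropositionalEquality

private variable
  ℓ₁ ℓ₂ p : Level
  X : Set ℓ₁
  n : ℕ

length≡1⇒∈-≡ : {xs : List X} {x y : X} → length xs ≡ 1 → x ∈ xs → y ∈ xs → x ≡ y
length≡1⇒∈-≡ {xs = _ ∷ []} _ (here refl) (here refl) = refl

unique-constant⇒length≡1 : {xs : List X} {x : X} →
  Unique xs → x ∈ xs → (∀ {y} → y ∈ xs → y ≡ x) → length xs ≡ 1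
unique-constant⇒length≡1 {xs = _ ∷ []}    _                  _ _        = refl
unique-constant⇒length≡1 {xs = _ ∷ _ ∷ _} ((y≢z ∷ _) ∷ _) _ constant =
  contradiction (trans (constant (here refl)) (sym (constant (there (here refl))))) y≢z

module _ {P : Pred X p} (P? : Decidable P) where

  length-filter≡1⇔ : {xs : List X} {x : X} → Unique xs → x ∈ xs → P x →
    length (filter P? xs) ≡ 1 ⇔ (∀ {y} → y ∈ xs → P y → y ≡ x)
  length-filter≡1⇔ xs! x∈xs px = mk⇔
    (λ length≡1 {y} y∈xs py → length≡1⇒∈-≡ length≡1 (∈-filter⁺ P? y∈xs py) (∈-filter⁺ P? x∈xs px))
    (λ only-x → unique-constant⇒length≡1 (Unique.filter⁺ P? xs!) (∈-filter⁺ P? x∈xs px)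
                  (λ {y} y∈filter → let (y∈xs , py) = ∈-filter⁻ P? y∈filter in only-x y∈xs py))

  length-filter-∷ : (x : X) (xs : List X) →
    length (filter P? (x ∷ xs)) ℕ.≤ suc (length (filter P? xs))
  length-filter-∷ x xs with P? x
  ... | yes _ = ℕₚ.≤-refl
  ... | no  _ = ℕₚ.n≤1+n _

  length-filter-map : {Y : Set ℓ₂} (f : Y → X) (ys : List Y) →
    length (filter P? (map f ys)) ≡ length (filter (P? ∘ f) ys)
  length-filter-map f []       = refl
  length-filter-map f (y ∷ ys) with P? (f y)
  ... | yes _ = cong suc (length-filter-map f ys)
  ... | no  _ = length-filter-map f ys

length-filter-allFin≤ : {P : Pred (Fin n) p} (P? : Decidable P) (i : Fin n) →
  (∀ {j} → P j → j F.≤ i) → length (filter P? (allFin n)) ℕ.≤ suc (toℕ i)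
length-filter-allFin≤ {n = suc n} {P = P} P? i bounded = begin
  length (filter P? (allFin (suc n)))                 ≤⟨ length-filter-∷ P? F.zero (tabulate F.suc) ⟩
  suc (length (filter P? (tabulate F.suc)))           ≡⟨ cong (suc ∘ length ∘ filter P?) (map-tabulate (λ j → j) F.suc) ⟨
  suc (length (filter P? (map F.suc (allFin n))))     ≡⟨ cong suc (length-filter-map P? F.suc (allFin n)) ⟩
  suc (length (filter (P? ∘ F.suc) (allFin n)))       ≤⟨ s≤s (tail i bounded) ⟩
  suc (toℕ i)                                         ∎
  where
  open ℕₚ.≤-Reasoning
  tail : (i : Fin (suc n)) → (∀ {j} → P j → j F.≤ i) →
    length (filter (P? ∘ F.suc) (allFin n)) ℕ.≤ toℕ i
  tail F.zero    bounded = ℕₚ.≤-reflexive (cong length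
    (filter-none (P? ∘ F.suc) {allFin n} (All.universal (λ _ → ℕₚ.n≮0 ∘ bounded) _)))
  tail (F.suc i) bounded = length-filter-allFin≤ (P? ∘ F.suc) i (ℕ.s≤s⁻¹ ∘ bounded)

module _ (π : Permutation′ n) (i : Fin n) where

  private
    WeaklyBelow : Pred (Fin n) _
    WeaklyBelow j = j F.≤ i × π ⟨$⟩ʳ j F.≤ π ⟨$⟩ʳ i

    weaklyBelow? : Decidable WeaklyBelow
    weaklyBelow? j = (j ≤? i) ×-dec (π ⟨$⟩ʳ j ≤? π ⟨$⟩ʳ i)

    lookup-Leh : lookup (Leh π) i ≡ length (filter weaklyBelow? (allFin n))
    lookup-Leh = lookup∘tabulate _ i

    i-weaklyBelow : WeaklyBelow i
    i-weaklyBelow = Fₚ.≤-refl , Fₚ.≤-refl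

  Leh≡1⇔ : lookup (Leh π) i ≡ 1 ⇔ (∀ j → j F.≤ i → π ⟨$⟩ʳ j F.≤ π ⟨$⟩ʳ i → j ≡ i)
  Leh≡1⇔ rewrite lookup-Leh = ⇔.trans
    (length-filter≡1⇔ weaklyBelow? (Unique.allFin⁺ n) (∈-allFin i) i-weaklyBelow)
    (mk⇔ (λ only-i j j≤i πj≤πi → only-i (∈-allFin j) (j≤i , πj≤πi))
         (λ only-i {j} _ (j≤i , πj≤πi) → only-i j j≤i πj≤πi))

  Leh-bounds : 1 ℕ.≤ lookup (Leh π) i × lookup (Leh π) i ℕ.≤ suc (toℕ i)
  Leh-bounds rewrite lookup-Leh =
      filter-some weaklyBelow? (lose (∈-allFin i) i-weaklyBelow)
    , length-filter-allFin≤ weaklyBelow? i proj₁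

∈Lmil⇔ : (σ : Permutation′ n) (v : Fin n) →
  v ∈Lmil σ ⇔ (∀ w → w F.≤ v → σ ⟨$⟩ˡ w F.≤ σ ⟨$⟩ˡ v → w ≡ v)
∈Lmil⇔ σ v = mk⇔ to from
  where
  to : v ∈Lmil σ → ∀ w → w F.≤ v → σ ⟨$⟩ˡ w F.≤ σ ⟨$⟩ˡ v → w ≡ v
  to (i , refl , minimal) w w≤v σ⁻¹w≤σ⁻¹v with σ ⟨$⟩ˡ w ≟ i
  ... | yes σ⁻¹w≡i = trans (sym (inverseʳ σ)) (cong (σ ⟨$⟩ʳ_) σ⁻¹w≡i)
  ... | no  σ⁻¹w≢i = contradiction w≤v (ℕₚ.<⇒≱ (subst (σ ⟨$⟩ʳ i F.<_) (inverseʳ σ) (minimal _ σ⁻¹w<i)))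
    where
    σ⁻¹w<i : σ ⟨$⟩ˡ w F.< i
    σ⁻¹w<i = Fₚ.≤∧≢⇒< (subst (σ ⟨$⟩ˡ w F.≤_) (inverseˡ σ) σ⁻¹w≤σ⁻¹v) σ⁻¹w≢i

  from : (∀ w → w F.≤ v → σ ⟨$⟩ˡ w F.≤ σ ⟨$⟩ˡ v → w ≡ v) → v ∈Lmil σ
  from only-v = σ ⟨$⟩ˡ v , inverseʳ σ , minimal
    where
    minimal : ∀ j → j F.< σ ⟨$⟩ˡ v → σ ⟨$⟩ʳ (σ ⟨$⟩ˡ v) F.< σ ⟨$⟩ʳ j
    minimal j j<σ⁻¹v with σ ⟨$⟩ʳ j ≤? v
    ... | no  σj≰v = subst (F._< σ ⟨$⟩ʳ j) (sym (inverseʳ σ)) (ℕₚ.≰⇒> σj≰v)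
    ... | yes σj≤v = contradiction (cong (σ ⟨$⟩ˡ_) σj≡v) (subst (_≢ σ ⟨$⟩ˡ v) (sym (inverseˡ σ)) (Fₚ.<⇒≢ j<σ⁻¹v))
      where
      σj≡v : σ ⟨$⟩ʳ j ≡ v
      σj≡v = only-v (σ ⟨$⟩ʳ j) σj≤v (subst (F._≤ σ ⟨$⟩ˡ v) (sym (inverseˡ σ)) (ℕₚ.<⇒≤ j<σ⁻¹v))

∈Lmil⇔A≡1 : (σ : Permutation′ n) (v : Fin n) → v ∈Lmil σ ⇔ lookup (A σ) v ≡ 1
∈Lmil⇔A≡1 σ v = ⇔.trans (∈Lmil⇔ σ v) (⇔.sym (Leh≡1⇔ (inv σ) v))

iterate : (X → X) → ℕ → X → X
iterate f zero    x = x
iterate f (suc k) x = iterate f k (f x)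

iterate-+ : (f : X → X) (m k : ℕ) (x : X) → iterate f (m + k) x ≡ iterate f k (iterate f m x)
iterate-+ f zero    k x = refl
iterate-+ f (suc m) k x = iterate-+ f m k (f x)

iterate-injective : {f : X → X} → Injective _≡_ _≡_ f → (k : ℕ) → Injective _≡_ _≡_ (iterate f k)
iterate-injective f-injective zero    eq = eq
iterate-injective f-injective (suc k) eq = f-injective (iterate-injective f-injective k eq)

data FirstBelow (ρ : Fin n → Fin n) (i : Fin n) : Fin n → Fin n → Set where
  now   : ∀ {x y}   → ρ x ≡ y → y F.≤ i → FirstBelow ρ i x y
  later : ∀ {x y z} → ρ x ≡ z → i F.< z → FirstBelow ρ i z y → FirstBelow ρ i x y

steps : {ρ : Fin n → Fin n} {i x y : Fin n} → FirstBelow ρ i x y → ℕ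
steps (now _ _)      = 1
steps (later _ _ fb) = suc (steps fb)

module _ {ρ : Fin n → Fin n} {i : Fin n} where

  FirstBelow-above : ∀ {x y} (fb : FirstBelow ρ i x y) {k} →
    0 ℕ.< k → k ℕ.< steps fb → i F.< iterate ρ k x
  FirstBelow-above (now _ _)         {suc k}       _ (s≤s ())
  FirstBelow-above (later refl i<z _) {suc zero}    _ _         = i<z
  FirstBelow-above (later refl _ fb)  {suc (suc k)} _ (s≤s k<s) = FirstBelow-above fb ℕₚ.0<1+n k<s

  steps-≤ : Injective _≡_ _≡_ ρ → ∀ {y} (fb : FirstBelow ρ i i y) → steps fb ℕ.≤ n
  steps-≤ ρ-injective fb = ℕₚ.≮⇒≥ λ n<steps →
    let (a , b , a<b , same) = Fₚ.pigeonhole n<steps (λ k → iterate ρ (toℕ k) i)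
        d = toℕ b ∸ toℕ a
        returns : i ≡ iterate ρ d i
        returns = iterate-injective ρ-injective (toℕ a) (begin
          iterate ρ (toℕ a) i              ≡⟨ same ⟩
          iterate ρ (toℕ b) i              ≡⟨ cong (λ k → iterate ρ k i) (ℕₚ.m∸n+n≡m (ℕₚ.<⇒≤ a<b)) ⟨
          iterate ρ (d + toℕ a) i          ≡⟨ iterate-+ ρ d (toℕ a) i ⟩
          iterate ρ (toℕ a) (iterate ρ d i) ∎)
        d<steps = ℕₚ.≤-<-trans (ℕₚ.m∸n≤m (toℕ b) (toℕ a)) (Fₚ.toℕ<n b)
    in ℕₚ.<-irrefl (cong toℕ returns) (FirstBelow-above fb (ℕₚ.m<n⇒0<n∸m a<b) d<steps)
    where open ≡-Reasoning

firstBelow-complete : (τ : Permutation′ n) {i x y : Fin n} (fb : FirstBelow (τ ⟨$⟩ˡ_) i x y)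
  {fuel : ℕ} → steps fb ℕ.≤ fuel → firstBelow τ i fuel x ≡ y
firstBelow-complete τ {i} {x} (now refl y≤i) {suc _} _ with τ ⟨$⟩ˡ x ≤? i
... | yes _   = refl
... | no  y≰i = contradiction y≤i y≰i
firstBelow-complete τ {i} {x} (later refl i<z fb) {suc _} (s≤s steps≤fuel) with τ ⟨$⟩ˡ x ≤? i
... | yes z≤i = contradiction z≤i (ℕₚ.<⇒≱ i<z)
... | no  _   = firstBelow-complete τ fb steps≤fuel

module _ (i j : Fin n) where

  transpose-matchˡ : PC.transpose i j i ≡ j
  transpose-matchˡ with i ≟ i
  ... | yes _   = refl
  ... | no  i≢i = contradiction refl i≢i

  transpose-matchʳ : PC.transpose i j j ≡ i
  transpose-matchʳ with j ≟ i
  ... | yes j≡i = j≡i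
  ... | no  _ with j ≟ j
  ...   | yes _   = refl
  ...   | no  j≢j = contradiction refl j≢j

  transpose-noMatch : ∀ {k} → k ≢ i → k ≢ j → PC.transpose i j k ≡ k
  transpose-noMatch {k} k≢i k≢j with k ≟ i
  ... | yes k≡i = contradiction k≡i k≢i
  ... | no  _ with k ≟ j
  ...   | yes k≡j = contradiction k≡j k≢j
  ...   | no  _   = refl

module _ {ρ : Fin n → Fin n} (ρ-injective : Injective _≡_ _≡_ ρ)
         {M : Fin n} (ρM≡M : ρ M ≡ M) (b : Fin n) {i : Fin n} (i<M : i F.< M) where

  private
    ρ′ : Fin n → Fin n
    ρ′ = PC.transpose b M ∘ ρ

    ρ-avoids-M : ∀ {x} → x ≢ M → ρ x ≢ M
    ρ-avoids-M x≢M ρx≡M = x≢M (ρ-injective (trans ρx≡M (sym ρM≡M)))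

    ρ′M≡b : ρ′ M ≡ b
    ρ′M≡b = trans (cong (PC.transpose b M) ρM≡M) (transpose-matchʳ b M)

  FirstBelow-transpose : ∀ {x y} → x ≢ M → FirstBelow ρ i x y → FirstBelow (PC.transpose b M ∘ ρ) i x y
  FirstBelow-reroute : ∀ {w x y} → x ≢ M → PC.transpose b M (ρ w) ≡ ρ x →
    FirstBelow ρ i x y → FirstBelow (PC.transpose b M ∘ ρ) i w y

  FirstBelow-transpose {x} x≢M fb with ρ x ≟ b
  ... | yes ρx≡b = later (trans (cong (PC.transpose b M) ρx≡b) (transpose-matchˡ b M)) i<M
                     (FirstBelow-reroute x≢M (trans ρ′M≡b (sym ρx≡b)) fb)
  ... | no  ρx≢b = FirstBelow-reroute x≢M (transpose-noMatch b M ρx≢b (ρ-avoids-M x≢M)) fb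

  FirstBelow-reroute x≢M ρ′w≡ρx (now ρx≡y y≤i)      = now (trans ρ′w≡ρx ρx≡y) y≤i
  FirstBelow-reroute x≢M ρ′w≡ρx (later ρx≡z i<z fb) =
    later (trans ρ′w≡ρx ρx≡z) i<z (FirstBelow-transpose (ρ-avoids-M x≢M ∘ trans ρx≡z) fb)

⟨$⟩ˡ-injective : (π : Permutation′ n) → Injective _≡_ _≡_ (π ⟨$⟩ˡ_)
⟨$⟩ˡ-injective π {x} {y} eq = trans (sym (inverseʳ π)) (trans (cong (π ⟨$⟩ʳ_) eq) (inverseʳ π))

module Construction (c : Fin n → Fin n) (c≤ : ∀ i → c i F.≤ i) where

  stage : ∀ m → m ℕ.≤ n → Permutation′ n
  stage zero    _   = P.id
  stage (suc m) m<n = P.transpose (F.fromℕ< m<n) (c (F.fromℕ< m<n)) P.∘ₚ stage m (ℕₚ.<⇒≤ m<n)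

  record Invariant (m : ℕ) (m≤n : m ℕ.≤ n) : Set where
    field
      fixes   : ∀ x → m ℕ.≤ toℕ x → stage m m≤n ⟨$⟩ˡ x ≡ x
      reaches : ∀ i → toℕ i ℕ.< m → FirstBelow (stage m m≤n ⟨$⟩ˡ_) i i (c i)

  invariant : ∀ m (m≤n : m ℕ.≤ n) → Invariant m m≤n
  invariant zero    _   = record { fixes = λ _ _ → refl ; reaches = λ _ () }
  invariant (suc m) m<n = record { fixes = fixes′ ; reaches = reaches′ }
    where
    open Invariant (invariant m (ℕₚ.<⇒≤ m<n))
    M = F.fromℕ< m<n
    b = c M
    ρ = stage m (ℕₚ.<⇒≤ m<n) ⟨$⟩ˡ_

    toℕ-M : toℕ M ≡ m
    toℕ-M = Fₚ.toℕ-fromℕ< m<n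

    ρM≡M : ρ M ≡ M
    ρM≡M = fixes M (ℕₚ.≤-reflexive (sym toℕ-M))

    fixes′ : ∀ x → suc m ℕ.≤ toℕ x → PC.transpose b M (ρ x) ≡ x
    fixes′ x m<x rewrite fixes x (ℕₚ.<⇒≤ m<x) = transpose-noMatch b M
      (λ x≡b → ℕₚ.<⇒≱ m<x (subst (λ y → toℕ y ℕ.≤ m) (sym x≡b) (subst (toℕ b ℕ.≤_) toℕ-M (c≤ M))))
      (λ x≡M → ℕₚ.<⇒≢ m<x (sym (trans (cong toℕ x≡M) toℕ-M)))

    reaches′ : ∀ i → toℕ i ℕ.< suc m → FirstBelow (PC.transpose b M ∘ ρ) i i (c i)
    reaches′ i i≤m with ℕₚ.m≤n⇒m<n∨m≡n (ℕ.s≤s⁻¹ i≤m)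
    ... | inj₁ i<m = FirstBelow-transpose (⟨$⟩ˡ-injective (stage m (ℕₚ.<⇒≤ m<n))) ρM≡M b i<M
                       (Fₚ.<⇒≢ i<M) (reaches i i<m)
      where i<M = subst (toℕ i ℕ.<_) (sym toℕ-M) i<m
    ... | inj₂ i≡m rewrite Fₚ.toℕ-injective (trans i≡m (sym toℕ-M)) =
      now (trans (cong (PC.transpose b M) ρM≡M) (transpose-matchʳ b M)) (c≤ M)

  firstBelow-surjective : Σ (Permutation′ n) λ τ → ∀ i → firstBelow τ i n i ≡ c i
  firstBelow-surjective = τ , λ i →
    let fb = Invariant.reaches (invariant n ℕₚ.≤-refl) i (Fₚ.toℕ<n i)
    in firstBelow-complete τ fb (steps-≤ (⟨$⟩ˡ-injective τ) fb)
    where τ = stage n ℕₚ.≤-refl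

IsLehmerCode : Vec ℕ n → Set
IsLehmerCode ℓ = ∀ i → 1 ℕ.≤ lookup ℓ i × lookup ℓ i ℕ.≤ suc (toℕ i)

B-surjective : (ℓ : Vec ℕ n) → IsLehmerCode ℓ → Σ (Permutation′ n) λ τ → B τ ≡ ℓ
B-surjective {n} ℓ code = τ , (begin
  B τ                          ≡⟨ tabulate-cong (cong (suc ∘ toℕ) ∘ firstBelow≡c) ⟩
  Vec.tabulate (suc ∘ toℕ ∘ c) ≡⟨ tabulate-cong suc-c ⟩
  Vec.tabulate (lookup ℓ)      ≡⟨ tabulate∘lookup ℓ ⟩
  ℓ                            ∎)
  where
  open ≡-Reasoning
  pred-ℓ≤i : ∀ i → lookup ℓ i ∸ 1 ℕ.≤ toℕ i
  pred-ℓ≤i i = ℕₚ.∸-monoˡ-≤ 1 (proj₂ (code i))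
  c : Fin n → Fin n
  c i = F.fromℕ< (ℕₚ.≤-<-trans (pred-ℓ≤i i) (Fₚ.toℕ<n i))
  toℕ-c : ∀ i → toℕ (c i) ≡ lookup ℓ i ∸ 1
  toℕ-c i = Fₚ.toℕ-fromℕ< _
  suc-c : ∀ i → suc (toℕ (c i)) ≡ lookup ℓ i
  suc-c i = trans (cong suc (toℕ-c i)) (ℕₚ.m+[n∸m]≡n (proj₁ (code i)))
  open Construction c (λ i → subst (ℕ._≤ toℕ i) (sym (toℕ-c i)) (pred-ℓ≤i i))
  τ = proj₁ firstBelow-surjective
  firstBelow≡c = proj₂ firstBelow-surjective

lemma2p3 : (n : ℕ) (σ : Permutation′ n) →
    Σ (Permutation′ n) (λ τ → B τ ≡ A σ)
    × ((τ : Permutation′ n) → B τ ≡ A σ → (v : Fin n) → (v ∈Lmil σ) ⇔ (v ∈Lmic₁ τ))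
lemma2p3 n σ = B-surjective (A σ) (Leh-bounds (inv σ)) , Lmil≡Lmic₁
  where
  Lmil≡Lmic₁ : (τ : Permutation′ n) → B τ ≡ A σ → (v : Fin n) → v ∈Lmil σ ⇔ v ∈Lmic₁ τ
  Lmil≡Lmic₁ τ Bτ≡Aσ v = subst (λ ℓ → v ∈Lmil σ ⇔ v ∈O ℓ) (sym Bτ≡Aσ) (∈Lmil⇔A≡1 σ v)
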